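{- Let $N>2$, let $p_1,p_2,\dots,p_J$ be any enumeration of $PV_N$ (so $J=2^{N-1}-1$), and for $j=1,\dots,J$ let $Q_j(x)=1$ if $\varphi(x,p_i)=1$ for some $i\le j$ and $Q_j(x)=0$ otherwise ($x\in\{0,1\}^{N^2}$). Let $W_j=\{x\in\{0,1\}^{N^2}: Q_j(x)=1\}$ and $W=\{x\in\{0,1\}^{N^2}: Par_N(x)=1\}$. Then $W_1\subseteq W_2\subseteq\cdots\subseteq W_J$, each inclusion is strict, i.e. $W_{j+1}\setminus W_j\neq\emptyset$ for $j=1,\dots,J-1$, and $W_J=W$.
   Context: A partition vector of length $N$ is $p\in\{1,-1\}^N$; $PV_N$ is the set of partition vectors with $p_1=1$ other than the all-ones vector, $|PV_N|=2^{N-1}-1$. For $\Omega=(\alpha_1,\dots,\alpha_N)$, $\langle p,\Omega\rangle=\sum_i p_i\alpha_i$. For $x\in\{0,1\}^{N^2}$, $\Omega_x$ is obtained by cutting $x$ from left to right into $N$ blocks of $N$ bits, each read in binary (most significant bit first) as an integer in $\{0,\dots,2^N-1\}$. Define $\varphi(x,p)=1$ if $\langle p,\Omega_x\rangle=0$ and $\varphi(x,p)=0$ otherwise. $Par_N(x)=1$ iff $\varphi(x,p)=1$ for some $p\in PV_N$. -}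

module Defs where

open import Data.Bool using (Bool; true; false; if_then_else_)
open import Data.Nat using (ℕ; zero; suc; _+_; _*_; _∸_; _^_; _≤_; _<_)
open import Data.Integer as ℤ using (ℤ; +_; -_)
import Data.Integer.Properties as ℤP
open import Data.Vec using (Vec; []; _∷_; take; drop; foldl; replicate)
open import Data.Fin using (Fin; toℕ)
open import Data.Product using (Σ; ∃; _×_; _,_)
open import Data.Empty using (⊥)
open import Relation.Binary.PropositionalEquality using (_≡_; _≢_)
open import Relation.Nullary.Decidable using (⌊_⌋)

data Sign : Set where
  plus minus : Sign

signVal : Sign → ℤ → ℤ
signVal plus  a = a
signVal minus a = - a

PartVec : ℕ → Set
PartVec N = Vec Sign N

FirstPlus : ∀ {N} → PartVec N → Set
FirstPlus []       = ⊥
FirstPlus (s ∷ _)  = s ≡ plus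

InPV : ∀ {N} → PartVec N → Set
InPV {N} p = FirstPlus p × (p ≢ replicate N plus)

fromBits : ∀ {n} → Vec Bool n → ℕ
fromBits = foldl _ (λ acc b → 2 * acc + (if b then 1 else 0)) 0

blocks : ∀ m n → Vec Bool (m * n) → Vec ℕ m
blocks zero    n []  = []
blocks (suc m) n xs  = fromBits (take n xs) ∷ blocks m n (drop n xs)

Omega : ∀ N → Vec Bool (N * N) → Vec ℕ N
Omega N x = blocks N N x

inner : ∀ {N} → PartVec N → Vec ℕ N → ℤ
inner []      []      = + 0
inner (s ∷ p) (a ∷ Ω) = signVal s (+ a) ℤ.+ inner p Ω

-- φ(x,p) ∈ {0,1}, rendered as a Bool (true = 1)
phi : ∀ N → Vec Bool (N * N) → PartVec N → Bool
phi N x p = ⌊ inner p (Omega N x) ℤ.≟ + 0 ⌋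

Par : ∀ N → Vec Bool (N * N) → Set
Par N x = Σ (PartVec N) λ p → InPV p × phi N x p ≡ true

numPV : ℕ → ℕ
numPV N = 2 ^ (N ∸ 1) ∸ 1

-- Given an enumeration e : Fin J → PV_N (e i = p_{i+1}), Q_j(x) = 1,
-- i.e. x ∈ W_j, for j ∈ {1,…,J}: φ(x, p_i) = 1 for some 1 ≤ i ≤ j.
W : ∀ N → (Fin (numPV N) → PartVec N) → ℕ → Vec Bool (N * N) → Set
W N e j x = Σ (Fin (numPV N)) λ i → toℕ i < j × phi N x (e i) ≡ true

-- A partition vector p with p₁ = 1 that is not all ones has some pᵢ = -1.
-- Take Ω to be the powers 2^(N-2), …, 2, 1 with the value c of the signed
-- binary number obtained from p by deleting that -1 inserted at position i.
-- Then ⟨p,Ω⟩ = c - c = 0.  Conversely, if s has s₁ = 1 and ⟨s,Ω⟩ = 0, then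
-- sᵢ = 1 is impossible (both summands are positive), and for sᵢ = -1 the
-- remaining digits of s and of p spell the same signed binary number, hence
-- coincide.  So the bit string of Ω lies in W_{j+1} ∖ W_j when p = p_{j+1}.
module Submission where

open import Defs
import Data.Integer.Properties as ℤP
open import Algebra.Properties.AbelianGroup ℤP.+-0-abelianGroup using (∙-cancelˡ)
open import Algebra.Properties.CommutativeSemigroup ℤP.+-commutativeSemigroup
  using (x∙yz≈y∙xz)
open import Data.Bool using (Bool; true; false; if_then_else_)
open import Data.Bool.Properties using (T-≡)
open import Data.Empty using (⊥-elim)
open import Data.Fin using (Fin; zero; suc; toℕ; fromℕ<)
open import Data.Fin.Properties using (toℕ-fromℕ<; toℕ<n)
open import Data.Integer as ℤ using (ℤ; +_; -_; _+_; +<+; -<+; +≤+)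
open import Data.Nat as ℕ using (ℕ; zero; suc; _*_; _∸_; _^_; _≤_; _<_; _≤?_; z≤n; s≤s)
open import Data.Nat.Properties as ℕP using (≰⇒>)
open import Data.Nat.Tactic.RingSolver using (solve-∀)
open import Data.Product using (Σ; _×_; _,_; proj₁; proj₂)
open import Data.Vec
  using (Vec; []; _∷_; _++_; take; drop; foldl; concat; map; lookup; insertAt; removeAt; replicate)
open import Data.Vec.Properties using (take++drop≡id; ++-injective; insertAt-removeAt; ∷-injectiveʳ)
open import Data.Vec.Relation.Unary.All as All using (All; []; _∷_)
open import Function.Base using (_∘_)
open import Function.Bundles using (_⇔_; mk⇔; Equivalence)
open import Function.Definitions using (Injective)
open import Relation.Binary.PropositionalEquality
open import Relation.Nullary using (¬_; yes; no)
open import Relation.Nullary.Decidable using (toWitness; fromWitness)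

powersOfTwo : ∀ n → Vec ℕ n
powersOfTwo zero    = []
powersOfTwo (suc n) = 2 ^ n ∷ powersOfTwo n

signedBinary : ∀ {n} → Vec Sign n → ℤ
signedBinary {n} u = inner u (powersOfTwo n)

pos-2^-suc : ∀ n → + (2 ^ suc n) ≡ + (2 ^ n) + + (2 ^ n)
pos-2^-suc n = trans (cong (λ k → + (2 ^ n ℕ.+ k)) (ℕP.+-identityʳ (2 ^ n))) (ℤP.pos-+ (2 ^ n) (2 ^ n))

neg-2^-suc : ∀ n → - + (2 ^ suc n) ≡ - + (2 ^ n) + - + (2 ^ n)
neg-2^-suc n = trans (cong -_ (pos-2^-suc n)) (ℤP.neg-distrib-+ (+ (2 ^ n)) (+ (2 ^ n)))

-a<x⇒0<a+x : ∀ {a x} → - a ℤ.< x → + 0 ℤ.< a + x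
-a<x⇒0<a+x {a} {x} -a<x = subst (ℤ._< a + x) (ℤP.+-inverseʳ a) (ℤP.+-monoʳ-< a -a<x)

x<a⇒-a+x<0 : ∀ {a x} → x ℤ.< a → - a + x ℤ.< + 0
x<a⇒-a+x<0 {a} {x} x<a = subst (- a + x ℤ.<_) (ℤP.+-inverseˡ a) (ℤP.+-monoʳ-< (- a) x<a)

signedBinary-bounds : ∀ {n} (u : Vec Sign n) →
  - + (2 ^ n) ℤ.< signedBinary u × signedBinary u ℤ.< + (2 ^ n)
signedBinary-bounds []          = -<+ , +<+ (s≤s z≤n)
signedBinary-bounds {suc n} (plus ∷ u) =
  let lower , upper = signedBinary-bounds u in
  ℤP.≤-<-trans ℤP.neg-≤-pos (-a<x⇒0<a+x lower) ,
  subst (signedBinary (plus ∷ u) ℤ.<_) (sym (pos-2^-suc n)) (ℤP.+-monoʳ-< (+ (2 ^ n)) upper)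
signedBinary-bounds {suc n} (minus ∷ u) =
  let lower , upper = signedBinary-bounds u in
  subst (ℤ._< signedBinary (minus ∷ u)) (sym (neg-2^-suc n)) (ℤP.+-monoʳ-< (- + (2 ^ n)) lower) ,
  ℤP.<-≤-trans (x<a⇒-a+x<0 upper) (+≤+ z≤n)

signedBinary-plus-pos : ∀ {n} (u : Vec Sign n) → + 0 ℤ.< signedBinary (plus ∷ u)
signedBinary-plus-pos u = -a<x⇒0<a+x (proj₁ (signedBinary-bounds u))

signedBinary-plus-∣∣ : ∀ {n} (u : Vec Sign n) → + ℤ.∣ signedBinary (plus ∷ u) ∣ ≡ signedBinary (plus ∷ u)
signedBinary-plus-∣∣ u = ℤP.0≤i⇒+∣i∣≡i (ℤP.<⇒≤ (signedBinary-plus-pos u))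

signedBinary-minus-neg : ∀ {n} (u : Vec Sign n) → signedBinary (minus ∷ u) ℤ.< + 0
signedBinary-minus-neg u = x<a⇒-a+x<0 (proj₂ (signedBinary-bounds u))

signedBinary-injective : ∀ {n} → Injective _≡_ _≡_ (signedBinary {n})
signedBinary-injective {x = []}       {[]}       _  = refl
signedBinary-injective {suc n} {plus ∷ u} {plus ∷ v} eq =
  cong (plus ∷_) (signedBinary-injective (∙-cancelˡ (+ (2 ^ n)) _ _ eq))
signedBinary-injective {suc n} {minus ∷ u} {minus ∷ v} eq =
  cong (minus ∷_) (signedBinary-injective (∙-cancelˡ (- + (2 ^ n)) _ _ eq))
signedBinary-injective {x = plus ∷ u} {minus ∷ v} eq =
  ⊥-elim (ℤP.<-asym (signedBinary-plus-pos u) (subst (ℤ._< + 0) (sym eq) (signedBinary-minus-neg v)))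
signedBinary-injective {x = minus ∷ u} {plus ∷ v} eq =
  ⊥-elim (ℤP.<-asym (signedBinary-plus-pos v) (subst (ℤ._< + 0) eq (signedBinary-minus-neg u)))

inner-insertAt : ∀ {n} (s : Vec Sign n) (w : Vec ℕ n) i σ a →
  inner (insertAt s i σ) (insertAt w i a) ≡ signVal σ (+ a) + inner s w
inner-insertAt s       w       zero    σ a = refl
inner-insertAt (τ ∷ s) (b ∷ w) (suc i) σ a = begin
  signVal τ (+ b) + inner (insertAt s i σ) (insertAt w i a)
    ≡⟨ cong (λ z → signVal τ (+ b) + z) (inner-insertAt s w i σ a) ⟩
  signVal τ (+ b) + (signVal σ (+ a) + inner s w)
    ≡⟨ x∙yz≈y∙xz (signVal τ (+ b)) (signVal σ (+ a)) (inner s w) ⟩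
  signVal σ (+ a) + (signVal τ (+ b) + inner s w) ∎
  where open ≡-Reasoning

-- Ω of the header for p = plus ∷ q, where q has a minus sign at k.
isolatingWeights : ∀ {n} → Vec Sign (suc n) → Fin (suc n) → Vec ℕ (suc (suc n))
isolatingWeights {n} q k =
  insertAt (powersOfTwo (suc n)) (suc k) ℤ.∣ signedBinary (plus ∷ removeAt q k) ∣

inner-isolatingWeights : ∀ {n} (q t : Vec Sign (suc n)) k →
  inner (plus ∷ t) (isolatingWeights q k)
    ≡ signVal (lookup t k) (signedBinary (plus ∷ removeAt q k)) + signedBinary (plus ∷ removeAt t k)
inner-isolatingWeights {n} q t k = begin
  inner (plus ∷ t) (isolatingWeights q k)
    ≡⟨ cong (λ s → inner (plus ∷ s) (isolatingWeights q k)) (insertAt-removeAt t k) ⟨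
  inner (insertAt (plus ∷ removeAt t k) (suc k) (lookup t k)) (isolatingWeights q k)
    ≡⟨ inner-insertAt (plus ∷ removeAt t k) (powersOfTwo (suc n)) (suc k) (lookup t k) ∣c∣ ⟩
  signVal (lookup t k) (+ ∣c∣) + signedBinary (plus ∷ removeAt t k)
    ≡⟨ cong (λ c → signVal (lookup t k) c + signedBinary (plus ∷ removeAt t k))
         (signedBinary-plus-∣∣ (removeAt q k)) ⟩
  signVal (lookup t k) (signedBinary (plus ∷ removeAt q k)) + signedBinary (plus ∷ removeAt t k) ∎
  where
  open ≡-Reasoning
  ∣c∣ = ℤ.∣ signedBinary (plus ∷ removeAt q k) ∣

insertAt-removeAt-lookup : ∀ {A : Set} {n} (t : Vec A (suc n)) k {a} →
  lookup t k ≡ a → insertAt (removeAt t k) k a ≡ t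
insertAt-removeAt-lookup t k refl = insertAt-removeAt t k

isolatingWeights-annihilates : ∀ {n} (q : Vec Sign (suc n)) k → lookup q k ≡ minus →
  inner (plus ∷ q) (isolatingWeights q k) ≡ + 0
isolatingWeights-annihilates q k qₖ≡minus = begin
  inner (plus ∷ q) (isolatingWeights q k)    ≡⟨ inner-isolatingWeights q q k ⟩
  signVal (lookup q k) c + c                 ≡⟨ cong (λ σ → signVal σ c + c) qₖ≡minus ⟩
  - c + c                                    ≡⟨ ℤP.+-inverseˡ c ⟩
  + 0                                        ∎
  where
  open ≡-Reasoning
  c = signedBinary (plus ∷ removeAt q k)

isolatingWeights-unique : ∀ {n} (q t : Vec Sign (suc n)) k → lookup q k ≡ minus →
  inner (plus ∷ t) (isolatingWeights q k) ≡ + 0 → t ≡ q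
isolatingWeights-unique q t k qₖ≡minus t·Ω≡0
  with lookup t k in tₖ | inner-isolatingWeights q t k
... | plus  | t·Ω≡c+d = ⊥-elim (ℤP.<-irrefl (trans (sym t·Ω≡0) t·Ω≡c+d)
        (ℤP.+-mono-< (signedBinary-plus-pos (removeAt q k)) (signedBinary-plus-pos (removeAt t k))))
... | minus | t·Ω≡-c+d = begin
  t                                 ≡⟨ insertAt-removeAt-lookup t k tₖ ⟨
  insertAt (removeAt t k) k minus   ≡⟨ cong (λ r → insertAt r k minus) removeAt-t≡removeAt-q ⟩
  insertAt (removeAt q k) k minus   ≡⟨ insertAt-removeAt-lookup q k qₖ≡minus ⟩
  q                                 ∎
  where
  open ≡-Reasoning
  c = signedBinary (plus ∷ removeAt q k)
  d = signedBinary (plus ∷ removeAt t k)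
  removeAt-t≡removeAt-q : removeAt t k ≡ removeAt q k
  removeAt-t≡removeAt-q = ∷-injectiveʳ (signedBinary-injective {x = plus ∷ removeAt t k} {plus ∷ removeAt q k}
    (ℤP.i-j≡0⇒i≡j d c (trans (ℤP.+-comm d (- c)) (trans (sym t·Ω≡-c+d) t·Ω≡0))))

2^-<-2^-suc : ∀ n → 2 ^ n < 2 ^ suc n
2^-<-2^-suc n = ℕP.^-monoʳ-< 2 (s≤s (s≤s z≤n)) (ℕP.n<1+n n)

powersOfTwo-< : ∀ n → All (_< 2 ^ n) (powersOfTwo n)
powersOfTwo-< zero    = []
powersOfTwo-< (suc n) =
  2^-<-2^-suc n ∷ All.map (λ a<2^n → ℕP.<-trans a<2^n (2^-<-2^-suc n)) (powersOfTwo-< n)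

All-insertAt : ∀ {A : Set} {P : A → Set} {n} {xs : Vec A n} {x} →
  All P xs → P x → ∀ i → All P (insertAt xs i x)
All-insertAt Pxs        Px zero    = Px ∷ Pxs
All-insertAt (Py ∷ Pxs) Px (suc i) = Py ∷ All-insertAt Pxs Px i

isolatingWeights-< : ∀ {n} (q : Vec Sign (suc n)) k → All (_< 2 ^ suc (suc n)) (isolatingWeights q k)
isolatingWeights-< {n} q k =
  All.map (λ a<2^n+1 → ℕP.<-trans a<2^n+1 (2^-<-2^-suc (suc n)))
    (All-insertAt (powersOfTwo-< (suc n)) ∣c∣<2^n+1 (suc k))
  where
  c = signedBinary (plus ∷ removeAt q k)
  ∣c∣<2^n+1 : ℤ.∣ c ∣ < 2 ^ suc n
  ∣c∣<2^n+1 = ℤP.drop‿+<+ (subst (ℤ._< + (2 ^ suc n))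
    (sym (signedBinary-plus-∣∣ (removeAt q k)))
    (proj₂ (signedBinary-bounds (plus ∷ removeAt q k))))

bit : Bool → ℕ
bit b = if b then 1 else 0

toBits : ∀ n → ℕ → Vec Bool n
toBits zero    a = []
toBits (suc n) a with 2 ^ n ≤? a
... | yes _ = true  ∷ toBits n (a ∸ 2 ^ n)
... | no  _ = false ∷ toBits n a

-- fromBits is a left fold; peeling off its first digit needs the accumulator general.
foldl-fromBits : ∀ {n} acc (bs : Vec Bool n) →
  foldl (λ _ → ℕ) (λ acc b → 2 * acc ℕ.+ bit b) acc bs ≡ acc * 2 ^ n ℕ.+ fromBits bs
foldl-fromBits acc []               = sym (trans (ℕP.+-identityʳ (acc * 1)) (ℕP.*-identityʳ acc))
foldl-fromBits {suc n} acc (b ∷ bs) = begin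
  foldl _ _ (2 * acc ℕ.+ bit b) bs                ≡⟨ foldl-fromBits (2 * acc ℕ.+ bit b) bs ⟩
  (2 * acc ℕ.+ bit b) * 2 ^ n ℕ.+ fromBits bs      ≡⟨ shift acc (bit b) (2 ^ n) (fromBits bs) ⟩
  acc * 2 ^ suc n ℕ.+ (bit b * 2 ^ n ℕ.+ fromBits bs) ≡⟨ cong (acc * 2 ^ suc n ℕ.+_) (foldl-fromBits (bit b) bs) ⟨
  acc * 2 ^ suc n ℕ.+ fromBits (b ∷ bs)            ∎
  where
  open ≡-Reasoning
  shift : ∀ a c m r → (2 * a ℕ.+ c) * m ℕ.+ r ≡ a * (2 * m) ℕ.+ (c * m ℕ.+ r)
  shift = solve-∀

fromBits-toBits : ∀ n {a} → a < 2 ^ n → fromBits (toBits n a) ≡ a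
fromBits-toBits zero    {zero}  _         = refl
fromBits-toBits zero    {suc a} (s≤s ())
fromBits-toBits (suc n) {a} a<2^n+1 with 2 ^ n ≤? a
... | yes 2^n≤a = begin
  fromBits (true ∷ toBits n (a ∸ 2 ^ n))       ≡⟨ foldl-fromBits 1 (toBits n (a ∸ 2 ^ n)) ⟩
  1 * 2 ^ n ℕ.+ fromBits (toBits n (a ∸ 2 ^ n)) ≡⟨ cong₂ ℕ._+_ (ℕP.*-identityˡ (2 ^ n)) (fromBits-toBits n a∸2^n<2^n) ⟩
  2 ^ n ℕ.+ (a ∸ 2 ^ n)                        ≡⟨ ℕP.m+[n∸m]≡n 2^n≤a ⟩
  a                                            ∎
  where
  open ≡-Reasoning
  a∸2^n<2^n : a ∸ 2 ^ n < 2 ^ n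
  a∸2^n<2^n = subst (a ∸ 2 ^ n <_)
    (trans (ℕP.m+n∸m≡n (2 ^ n) (2 ^ n ℕ.+ 0)) (ℕP.+-identityʳ (2 ^ n)))
    (ℕP.∸-monoˡ-< a<2^n+1 2^n≤a)
... | no  2^n≰a = trans (foldl-fromBits 0 (toBits n a)) (fromBits-toBits n (≰⇒> 2^n≰a))

take-++ : ∀ {A : Set} {m n} (xs : Vec A m) (ys : Vec A n) → take m (xs ++ ys) ≡ xs
take-++ {m = m} xs ys = proj₁ (++-injective (take m (xs ++ ys)) xs (take++drop≡id m (xs ++ ys)))

drop-++ : ∀ {A : Set} {m n} (xs : Vec A m) (ys : Vec A n) → drop m (xs ++ ys) ≡ ys
drop-++ {m = m} xs ys = proj₂ (++-injective (take m (xs ++ ys)) xs (take++drop≡id m (xs ++ ys)))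

blocks-concat-toBits : ∀ m n (Ω : Vec ℕ m) → All (_< 2 ^ n) Ω →
  blocks m n (concat (map (toBits n) Ω)) ≡ Ω
blocks-concat-toBits zero    n []      []               = refl
blocks-concat-toBits (suc m) n (a ∷ Ω) (a<2^n ∷ Ω<2^n) = cong₂ _∷_
  (trans (cong fromBits (take-++ (toBits n a) rest)) (fromBits-toBits n a<2^n))
  (trans (cong (blocks m n) (drop-++ (toBits n a) rest)) (blocks-concat-toBits m n Ω Ω<2^n))
  where rest = concat (map (toBits n) Ω)

phi≡true⇔ : ∀ N x (p : PartVec N) → phi N x p ≡ true ⇔ inner p (Omega N x) ≡ + 0
phi≡true⇔ N x p = mk⇔ (λ φ≡true → toWitness (Equivalence.from T-≡ φ≡true))
                      (λ p·Ω≡0 → Equivalence.to T-≡ (fromWitness p·Ω≡0))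

minus-index : ∀ {n} (q : Vec Sign n) → q ≢ replicate n plus → Σ (Fin n) λ k → lookup q k ≡ minus
minus-index []          q≢plusⁿ = ⊥-elim (q≢plusⁿ refl)
minus-index (minus ∷ q) _       = zero , refl
minus-index (plus ∷ q)  q≢plusⁿ =
  let k , qₖ≡minus = minus-index q (q≢plusⁿ ∘ cong (plus ∷_)) in suc k , qₖ≡minus

isolatingInput : ∀ {N} (p : PartVec N) → InPV p →
  Σ (Vec Bool (N * N)) λ x → phi N x p ≡ true × (∀ s → FirstPlus s → phi N x s ≡ true → s ≡ p)
isolatingInput {zero}        []          (() , _)
isolatingInput {suc _}       (minus ∷ _) (() , _)
isolatingInput {suc zero}    (plus ∷ []) (_ , p≢plusᴺ) = ⊥-elim (p≢plusᴺ refl)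
isolatingInput {suc (suc n)} (plus ∷ q)  (_ , p≢plusᴺ)
  with k , qₖ≡minus ← minus-index q (p≢plusᴺ ∘ cong (plus ∷_)) =
  x , Equivalence.from (φₓ≡true⇔ (plus ∷ q)) (isolatingWeights-annihilates q k qₖ≡minus) ,
  λ { (_ ∷ t) refl φₓ≡true →
        cong (plus ∷_) (isolatingWeights-unique q t k qₖ≡minus (Equivalence.to (φₓ≡true⇔ (plus ∷ t)) φₓ≡true)) }
  where
  x = concat (map (toBits (suc (suc n))) (isolatingWeights q k))
  φₓ≡true⇔ : ∀ s → phi _ x s ≡ true ⇔ inner s (isolatingWeights q k) ≡ + 0
  φₓ≡true⇔ s = subst (λ Ω → phi _ x s ≡ true ⇔ inner s Ω ≡ + 0)
    (blocks-concat-toBits _ _ (isolatingWeights q k) (isolatingWeights-< q k)) (phi≡true⇔ _ x s)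

module _ (N : ℕ) (e : Fin (numPV N) → PartVec N) where

  W-suc : ∀ {j} x → W N e j x → W N e (suc j) x
  W-suc x (i , i<j , φ≡true) = i , ℕP.m<n⇒m<1+n i<j , φ≡true

  W-suc-∖-W : Injective _≡_ _≡_ e → (∀ i → InPV (e i)) →
    ∀ {j} → j < numPV N → Σ (Vec Bool (N * N)) λ x → W N e (suc j) x × ¬ W N e j x
  W-suc-∖-W e-injective e-InPV {j} j<J
    with x , φ≡true , unique ← isolatingInput (e (fromℕ< j<J)) (e-InPV (fromℕ< j<J)) =
    x , (fromℕ< j<J , subst (_< suc j) (sym (toℕ-fromℕ< j<J)) (ℕP.n<1+n j) , φ≡true) ,
    λ { (i , i<j , φᵢ≡true) → ℕP.<-irrefl
          (trans (cong toℕ (e-injective (unique (e i) (proj₁ (e-InPV i)) φᵢ≡true))) (toℕ-fromℕ< j<J)) i<j }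

  W-numPV⇔Par : (∀ i → InPV (e i)) → (∀ p → InPV p → Σ (Fin (numPV N)) λ i → e i ≡ p) →
    ∀ x → W N e (numPV N) x ⇔ Par N x
  W-numPV⇔Par e-InPV e-surjective x = mk⇔
    (λ { (i , _ , φ≡true) → e i , e-InPV i , φ≡true })
    (λ { (p , p∈PV , φ≡true) → let i , eᵢ≡p = e-surjective p p∈PV in
           i , toℕ<n i , subst (λ p → phi N x p ≡ true) (sym eᵢ≡p) φ≡true })

lemma5p1 : (N : ℕ) → 2 < N →
    (e : Fin (numPV N) → PartVec N) →
    Injective _≡_ _≡_ e →
    (∀ i → InPV (e i)) →
    (∀ p → InPV p → Σ (Fin (numPV N)) λ i → e i ≡ p) →
    ((j : ℕ) → 1 ≤ j → j < numPV N →
        ((x : Vec Bool (N * N)) → W N e j x → W N e (suc j) x)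
        × Σ (Vec Bool (N * N)) (λ x → W N e (suc j) x × ¬ W N e j x))
    × ((x : Vec Bool (N * N)) → W N e (numPV N) x ⇔ Par N x)
lemma5p1 N _ e e-injective e-InPV e-surjective =
  (λ j _ j<J → W-suc N e , W-suc-∖-W N e e-injective e-InPV j<J) ,
  W-numPV⇔Par N e e-InPV e-surjective
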